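{- Let $n\in\mathbb{N}$, $R=\{1,3,9n-1,9n+1\}$, $S=\{3,3n+1,6n-1,12n+1\}$ and $T=\{3,3n-1,6n+1,12n-1\}$. Then $C_{27n}(R)$, $C_{27n}(S)$ and $C_{27n}(T)$ are Type-2 isomorphic circulant graphs w.r.t. $m=3$, $T2_{27n,3}(C_{27n}(R))=T2_{27n,3}(C_{27n}(S))=T2_{27n,3}(C_{27n}(T))=\{C_{27n}(R),C_{27n}(S),C_{27n}(T)\}$, and $(T2_{27n,3}(C_{27n}(R)),\circ)=(T2_{27n,3}(C_{27n}(S)),\circ)=(T2_{27n,3}(C_{27n}(T)),\circ)$ is a group (the Type-2 group).
   Context: Circulant graph $C_N(R)$: vertices $v_0,\dots,v_{N-1}$, $v_x$ adjacent to $v_{x\pm s}$, $s\in R$; jump sets written in $[1,N/2]$ after reflexive reduction modulo $N$ (reduce mod $N$, replace values $>N/2$ by $N$ minus the value). For $m\mid N$, $0\le t\le\tfrac Nm-1$, $\theta_{N,m,t}$ maps $v_x$, $x=qm+j$, $0\le j\le m-1$, to $u_{x+jmt}$ (subscripts mod $N$) and edges to pairs of images; $\theta_{N,m,t}(C_N(R))$ is the image graph, written $C_N(\theta_{N,m,t}(R))$. Type-2 isomorphism w.r.t. $m$: $C_N(R)$, $C_N(S)$ with $|R|=|S|\ge3$, $R\ne S$, are Type-2 isomorphic w.r.t. $m$ if some $r\in R$ has $m>1$, $m\mid\gcd(N,r)$, $m^3\mid N$, $\theta_{N,m,t}(C_N(R))=C_N(S)$ for some $1\le t\le\tfrac Nm-1$,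 and $S\ne xR$ (reflexive mod $N$) for all $x$ coprime to $N$. $T2_{N,m}(C_N(R))=\{C_N(R)\}\cup\{C_N(S):C_N(S)$ Type-2 isomorphic to $C_N(R)$ w.r.t. $m\}$, with operation $\theta_{N,m,t}(C_N(R))\circ\theta_{N,m,t'}(C_N(R))=\theta_{N,m,t+t'}(C_N(R))$, $t+t'$ modulo $\tfrac Nm$. -}

module Defs where

open import Data.Nat using (ℕ; zero; suc; _+_; _*_; _∸_; _^_; _≤_; _<_; _≤?_)
open import Data.Nat.Properties using (_≟_)
open import Data.Nat.DivMod using (_%_; _/_)
open import Data.Nat.Divisibility using (_∣_)
open import Data.Nat.GCD using (gcd)
open import Data.Nat.Coprimality using (Coprime)
open import Data.List using (List; map; length; deduplicate)
open import Data.List.Membership.Propositional using (_∈_)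
open import Data.List.Relation.Unary.All using (All)
open import Data.Product using (Σ; ∃; ∃-syntax; _×_; proj₁)
open import Data.Sum using (_⊎_)
open import Relation.Nullary using (¬_; yes; no)
open import Relation.Binary.PropositionalEquality using (_≡_)
open import Algebra.Structures using (IsGroup)

-- Total versions of mod / div (the divisor is always ≥ 1 in our uses;
-- the value at divisor 0 is an irrelevant convention).

_mod_ : ℕ → ℕ → ℕ
a mod zero    = a
a mod (suc k) = a % suc k

_div_ : ℕ → ℕ → ℕ
a div zero    = zero
a div (suc k) = a / suc k

_⇔_ : Set → Set → Set
A ⇔ B = (A → B) × (B → A)

red : ℕ → ℕ → ℕ
red N a with 2 * (a mod N) ≤? N
... | yes _ = a mod N
... | no  _ = N ∸ (a mod N)

redSet : ℕ → List ℕ → List ℕ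
redSet N R = map (red N) R

SetEq : List ℕ → List ℕ → Set
SetEq A B = ∀ a → (a ∈ A) ⇔ (a ∈ B)

card : ℕ → List ℕ → ℕ
card N R = length (deduplicate _≟_ (redSet N R))

scale : ℕ → ℕ → List ℕ → List ℕ
scale N x R = redSet N (map (x *_) R)

JumpSet : ℕ → List ℕ → Set
JumpSet N X = All (λ s → 1 ≤ s × 2 * s ≤ N) X

-- Graphs on the labelled vertex set {0, …, N-1} (vertex i = v_i resp. u_i),
-- given by their (symmetric) adjacency relation.

Graph : Set₁
Graph = ℕ → ℕ → Set

SameGraph : ℕ → Graph → Graph → Set
SameGraph N G H = ∀ u w → u < N → w < N → (G u w ⇔ H u w)

C : ℕ → List ℕ → Graph
C N R x y = ∃[ s ] (s ∈ R × ((x + s) mod N ≡ y ⊎ (y + s) mod N ≡ x))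

θ : ℕ → ℕ → ℕ → ℕ → ℕ
θ N m t x = (x + (x mod m) * m * t) mod N

Image : ℕ → ℕ → ℕ → List ℕ → Graph
Image N m t R u w =
  ∃[ x ] ∃[ y ] (x < N × y < N × C N R x y × θ N m t x ≡ u × θ N m t y ≡ w)

Type2Iso : ℕ → ℕ → List ℕ → List ℕ → Set
Type2Iso N m R S =
  card N R ≡ card N S × 3 ≤ card N R ×
  ¬ SetEq (redSet N R) (redSet N S) ×
  (∃[ r ] (r ∈ R × 1 < m × m ∣ gcd N r)) ×
  m ^ 3 ∣ N ×
  (∃[ t ] (1 ≤ t × t ≤ (N div m) ∸ 1 × SameGraph N (Image N m t R) (C N S))) ×
  (∀ x → Coprime x N → ¬ SetEq (redSet N S) (scale N x R))

InT2 : ℕ → ℕ → List ℕ → List ℕ → Set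
InT2 N m R X = SameGraph N (C N X) (C N R) ⊎ Type2Iso N m R X

T2Carrier : ℕ → ℕ → List ℕ → Set
T2Carrier N m R = Σ (List ℕ) (λ X → JumpSet N X × InT2 N m R X)

_≈T2_ : ∀ {N m R} → T2Carrier N m R → T2Carrier N m R → Set
_≈T2_ {N} a b = SameGraph N (C N (proj₁ a)) (C N (proj₁ b))

Rep : ∀ N m R → T2Carrier N m R → ℕ → Set
Rep N m R a t = SameGraph N (Image N m t R) (C N (proj₁ a))

-- (T2_{N,m}(C_N(R)), ∘) is a group, where ∘ is
--   θ_{N,m,t}(C_N(R)) ∘ θ_{N,m,t'}(C_N(R)) = θ_{N,m,t+t' mod N/m}(C_N(R)):
-- every element is some θ_{N,m,t}(C_N(R)) with 0 ≤ t < N/m, there is a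
-- binary operation on T2 realising ∘ (so ∘ is well defined and closed),
-- and together with some unit and inverse it satisfies the group axioms.
IsType2Group : ℕ → ℕ → List ℕ → Set
IsType2Group N m R =
  (∀ a → ∃[ t ] (t < N div m × Rep N m R a t)) ×
  Σ (T2Carrier N m R → T2Carrier N m R → T2Carrier N m R) λ _∘_ →
  Σ (T2Carrier N m R) λ e →
  Σ (T2Carrier N m R → T2Carrier N m R) λ inv →
    IsGroup (_≈T2_ {N} {m} {R}) _∘_ e inv ×
    (∀ a b t t' → Rep N m R a t → Rep N m R b t' →
       Rep N m R (a ∘ b) ((t + t') mod (N div m)))

-- Write N = 27n and M = 9n = N/3. Reduced modulo N, each of R, S, T is {3} ∪ {c : c ≡ ±a (mod M)}
-- with a = 1 + 3ni for i = 0, 1, 2. As soon as M ∣ 9t, the map θ_{N,3,t} multiplies every jump by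
-- 1 + 3t modulo M, and it keeps the jump 3 modulo N; since (1 + 3n)(1 + 3ni) ≡ 1 + 3n(i + 1) (mod M),
-- θ_{N,3,n} maps C_N(R) to C_N(S) to C_N(T) to C_N(R), and θ_{N,3,t} only depends on t mod 9n.
-- Conversely, if θ_{N,3,t} maps one of these graphs to a circulant graph, the mirror image of the
-- edge 0 — θ(a) pulls back to an edge 0 — y with y ≡ -a (mod M), and comparing residues mod 3 gives
-- M ∣ 9t, i.e. n ∣ t. So T2 consists of the three graphs, labelled by t/n mod 3, and is a copy of
-- ℤ/3. The three jump sets are told apart by their orbits ±a mod M, and no multiplier x relates
-- them: x must send 3 to ±3, hence x ≡ ±1 (mod M), and such an x fixes every orbit.
module Submission where

open import Defs
open import Data.Nat using (ℕ; _+_; _*_; _∸_; _≤_)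
open import Data.List using (List; _∷_; [])
open import Data.Product using (_×_)
open import Data.Sum using (_⊎_)

open import Algebra.Morphism.Structures using (IsGroupMonomorphism)
import Algebra.Morphism.GroupMonomorphism as GroupMonomorphism
open import Algebra.Structures using (IsGroup)
open import Data.Empty using (⊥-elim)
open import Data.List using (length; map)
open import Data.List.Membership.Propositional using (_∈_)
open import Data.List.Membership.Propositional.Properties using (∈-map⁺; ∈-map⁻; deduplicate-∈⇔)
open import Data.List.Membership.Propositional.Properties.WithK using (unique∧set⇒bag)
open import Data.List.Relation.Binary.BagAndSetEquality using (∼bag⇒↭)
open import Data.List.Relation.Binary.Permutation.Propositional.Properties using (↭-length)
open import Data.List.Relation.Unary.All as All using (All; []; _∷_; lookup)
open import Data.List.Relation.Unary.AllPairs as AllPairs using ([]; _∷_)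
open import Data.List.Relation.Unary.Any using (here; there)
open import Data.List.Relation.Unary.Linked using (Linked; [-]; _∷_)
open import Data.List.Relation.Unary.Linked.Properties using (Linked⇒AllPairs)
open import Data.List.Relation.Unary.Unique.Propositional using (Unique)
open import Data.Nat.Base using (zero; suc; _<_; NonZero; s≤s; z≤n; z<s; _%_; _/_; >-nonZero⁻¹)
open import Data.Nat.Coprimality using (Coprime)
open import Data.Nat.DivMod hiding (_mod_; _div_)
open import Data.Nat.Divisibility
  using ( _∣_; divides; quotient; ∣-refl; ∣-trans; ∣m+n∣m⇒∣n; ∣m⇒∣m*n; ∣n⇒∣m*n; ∣⇒≤; *-cancelˡ-∣
        ; m%n≡0⇒n∣m; n∣m⇒m%n≡0)
open import Data.Nat.GCD using (gcd-greatest)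
open import Data.Nat.Primality using (Prime; prime?; euclidsLemma)
open import Data.Nat.Properties
open import Data.List.Relation.Unary.Unique.DecPropositional.Properties _≟_ using (deduplicate-!)
open import Data.Nat.Tactic.RingSolver using (solve-∀; solve)
open import Data.Product using (∃-syntax; _,_; proj₁; proj₂)
open import Data.Sum as Sum using (inj₁; inj₂)
open import Function.Base using (_∘_)
open import Function.Bundles using (mk⇔; Equivalence)
open import Level using (0ℓ)
open import Relation.Binary.Bundles using (Setoid)
open import Relation.Binary.PropositionalEquality
import Relation.Binary.Reasoning.Setoid as SetoidReasoning
open import Relation.Nullary using (¬_; yes; no)
open import Relation.Nullary.Decidable using (from-yes)

-- Congruences modulo d

infix 4 _≡[_]_ _≡±[_]_

record _≡[_]_ (a d : ℕ) .{{_ : NonZero d}} (b : ℕ) : Set where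
  constructor mk≡mod
  field %≡% : a % d ≡ b % d

open _≡[_]_ public

data _≡±[_]_ (a d : ℕ) .{{_ : NonZero d}} (b : ℕ) : Set where
  pos : a ≡[ d ] b → a ≡±[ d ] b
  neg : a + b ≡[ d ] 0 → a ≡±[ d ] b

module _ {d : ℕ} .{{_ : NonZero d}} where

  ≡mod-refl : ∀ {a} → a ≡[ d ] a
  ≡mod-refl = mk≡mod refl

  ≡mod-sym : ∀ {a b} → a ≡[ d ] b → b ≡[ d ] a
  ≡mod-sym (mk≡mod a≡b) = mk≡mod (sym a≡b)

  ≡mod-trans : ∀ {a b c} → a ≡[ d ] b → b ≡[ d ] c → a ≡[ d ] c
  ≡mod-trans (mk≡mod a≡b) (mk≡mod b≡c) = mk≡mod (trans a≡b b≡c)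

  ≡⇒≡mod : ∀ {a b} → a ≡ b → a ≡[ d ] b
  ≡⇒≡mod a≡b = mk≡mod (cong (_% d) a≡b)

≡mod-setoid : (d : ℕ) .{{_ : NonZero d}} → Setoid 0ℓ 0ℓ
≡mod-setoid d = record
  { Carrier       = ℕ
  ; _≈_           = _≡[ d ]_
  ; isEquivalence = record { refl = ≡mod-refl ; sym = ≡mod-sym ; trans = ≡mod-trans }
  }

module ≡mod-Reasoning (d : ℕ) .{{_ : NonZero d}} = SetoidReasoning (≡mod-setoid d)

module _ {d : ℕ} .{{_ : NonZero d}} where

  0%d : 0 % d ≡ 0
  0%d = m*n%n≡0 0 d

  %-≡mod : ∀ a → a % d ≡[ d ] a
  %-≡mod a = mk≡mod (m%n%n≡m%n a d)

  +-multiple-≡mod : ∀ a q → a + q * d ≡[ d ] a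
  +-multiple-≡mod a q = mk≡mod ([m+kn]%n≡m%n a q d)

  multiple-≡mod-0 : ∀ q → q * d ≡[ d ] 0
  multiple-≡mod-0 q = mk≡mod (trans (m*n%n≡0 q d) (sym 0%d))

  ≡mod-+ : ∀ {a b c e} → a ≡[ d ] b → c ≡[ d ] e → a + c ≡[ d ] b + e
  ≡mod-+ {a} {b} {c} {e} (mk≡mod a≡b) (mk≡mod c≡e) = mk≡mod (begin
    (a + c) % d         ≡⟨ %-distribˡ-+ a c d ⟩
    (a % d + c % d) % d ≡⟨ cong₂ (λ x y → (x + y) % d) a≡b c≡e ⟩
    (b % d + e % d) % d ≡⟨ %-distribˡ-+ b e d ⟨
    (b + e) % d         ∎)
    where open ≡-Reasoning

  ≡mod-*ˡ : ∀ c {a b} → a ≡[ d ] b → c * a ≡[ d ] c * b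
  ≡mod-*ˡ c {a} {b} (mk≡mod a≡b) = mk≡mod (begin
    (c * a) % d           ≡⟨ %-distribˡ-* c a d ⟩
    (c % d * (a % d)) % d ≡⟨ cong (λ x → (c % d * x) % d) a≡b ⟩
    (c % d * (b % d)) % d ≡⟨ %-distribˡ-* c b d ⟨
    (c * b) % d           ∎)
    where open ≡-Reasoning

  ≡mod-cancelʳ-+ : ∀ {a b} c → a + c ≡[ d ] b + c → a ≡[ d ] b
  ≡mod-cancelʳ-+ {a} {b} c a+c≡b+c = begin
    a                  ≈⟨ +-multiple-≡mod a 1 ⟨
    a + 1 * d          ≡⟨ cong (a +_) c%d+c′≡d ⟨
    a + (c % d + c′)   ≈⟨ regroup a ⟩
    a + c + c′         ≈⟨ ≡mod-+ a+c≡b+c ≡mod-refl ⟩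
    b + c + c′         ≈⟨ regroup b ⟨
    b + (c % d + c′)   ≡⟨ cong (b +_) c%d+c′≡d ⟩
    b + 1 * d          ≈⟨ +-multiple-≡mod b 1 ⟩
    b                  ∎
    where
    open ≡mod-Reasoning d
    c′ = d ∸ c % d
    c%d+c′≡d : c % d + c′ ≡ 1 * d
    c%d+c′≡d = trans (m+[n∸m]≡n (m%n≤n c d)) (sym (*-identityˡ d))
    regroup : ∀ x → x + (c % d + c′) ≡[ d ] x + c + c′
    regroup x = ≡mod-trans (≡⇒≡mod (sym (+-assoc x (c % d) c′)))
                           (≡mod-+ (≡mod-+ {x} ≡mod-refl (%-≡mod c)) ≡mod-refl)

  ≡mod⇒≡ : ∀ {a b} → a < d → b < d → a ≡[ d ] b → a ≡ b
  ≡mod⇒≡ a<d b<d (mk≡mod a≡b) = trans (sym (m<n⇒m%n≡m a<d)) (trans a≡b (m<n⇒m%n≡m b<d))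

  ≡mod-0⇒∣ : ∀ {a} → a ≡[ d ] 0 → d ∣ a
  ≡mod-0⇒∣ {a} (mk≡mod a≡0) = m%n≡0⇒n∣m a d (trans a≡0 0%d)

  ∣⇒≡mod-0 : ∀ {a} → d ∣ a → a ≡[ d ] 0
  ∣⇒≡mod-0 {a} d∣a = mk≡mod (trans (n∣m⇒m%n≡0 a d d∣a) (sym 0%d))

  ≡mod-∣ : ∀ {e} .{{_ : NonZero e}} → e ∣ d → ∀ {a b} → a ≡[ d ] b → a ≡[ e ] b
  ≡mod-∣ {e} e∣d {a} {b} (mk≡mod a≡b) = mk≡mod (begin
    a % e       ≡⟨ m∣n⇒o%n%m≡o%m e d a e∣d ⟨
    a % d % e   ≡⟨ cong (_% e) a≡b ⟩
    b % d % e   ≡⟨ m∣n⇒o%n%m≡o%m e d b e∣d ⟩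
    b % e       ∎)
    where open ≡-Reasoning

  ≡mod-*-cancelʳ : ∀ c .{{_ : NonZero c}} .{{_ : NonZero (d * c)}} {a b} →
                   a * c ≡[ d * c ] b * c → a ≡[ d ] b
  ≡mod-*-cancelʳ c {a} {b} (mk≡mod ac≡bc) = mk≡mod (*-cancelʳ-≡ (a % d) (b % d) c (begin
    a % d * c       ≡⟨ m%n*o≡m*o%[n*o] a d c ⟩
    a * c % (d * c) ≡⟨ ac≡bc ⟩
    b * c % (d * c) ≡⟨ m%n*o≡m*o%[n*o] b d c ⟨
    b % d * c       ∎))
    where open ≡-Reasoning

  pos-by : ∀ q {a b} → a ≡ b + q * d → a ≡±[ d ] b
  pos-by q {a} {b} a≡b+qd = pos (≡mod-trans (≡⇒≡mod a≡b+qd) (+-multiple-≡mod b q))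

  neg-by : ∀ q {a b} → a + b ≡ q * d → a ≡±[ d ] b
  neg-by q a+b≡qd = neg (≡mod-trans (≡⇒≡mod a+b≡qd) (multiple-≡mod-0 q))

  ≡±-sym : ∀ {a b} → a ≡±[ d ] b → b ≡±[ d ] a
  ≡±-sym         (pos a≡b)   = pos (≡mod-sym a≡b)
  ≡±-sym {a} {b} (neg a+b≡0) = neg (≡mod-trans (≡⇒≡mod (+-comm b a)) a+b≡0)

  ≡±-trans : ∀ {a b c} → a ≡±[ d ] b → b ≡±[ d ] c → a ≡±[ d ] c
  ≡±-trans     (pos a≡b)   (pos b≡c)   = pos (≡mod-trans a≡b b≡c)
  ≡±-trans     (pos a≡b)   (neg b+c≡0) = neg (≡mod-trans (≡mod-+ a≡b ≡mod-refl) b+c≡0)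
  ≡±-trans {a} (neg a+b≡0) (pos b≡c)   = neg (≡mod-trans (≡mod-+ {a} ≡mod-refl (≡mod-sym b≡c)) a+b≡0)
  ≡±-trans {a} {b} {c} (neg a+b≡0) (neg b+c≡0) =
    pos (≡mod-cancelʳ-+ b (≡mod-trans a+b≡0 (≡mod-sym (≡mod-trans (≡⇒≡mod (+-comm c b)) b+c≡0))))

  ≡±-*ˡ : ∀ c {a b} → a ≡±[ d ] b → c * a ≡±[ d ] c * b
  ≡±-*ˡ c (pos a≡b) = pos (≡mod-*ˡ c a≡b)
  ≡±-*ˡ c {a} {b} (neg a+b≡0) = neg (begin
    c * a + c * b ≡⟨ *-distribˡ-+ c a b ⟨
    c * (a + b)   ≈⟨ ≡mod-*ˡ c a+b≡0 ⟩
    c * 0         ≡⟨ *-zeroʳ c ⟩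
    0             ∎)
    where open ≡mod-Reasoning d

  ≡±-*ʳ : ∀ c {a b} → a ≡±[ d ] b → a * c ≡±[ d ] b * c
  ≡±-*ʳ c {a} {b} a≡±b = subst₂ _≡±[ d ]_ (*-comm c a) (*-comm c b) (≡±-*ˡ c a≡±b)

  ≡±-∣ : ∀ {e} .{{_ : NonZero e}} → e ∣ d → ∀ {a b} → a ≡±[ d ] b → a ≡±[ e ] b
  ≡±-∣ e∣d (pos a≡b)   = pos (≡mod-∣ e∣d a≡b)
  ≡±-∣ e∣d (neg a+b≡0) = neg (≡mod-∣ e∣d a+b≡0)

  ∣-≡± : ∀ {a c} → d ∣ c → c ≡±[ d ] a → d ∣ a
  ∣-≡± d∣c (pos c≡a)   = ≡mod-0⇒∣ (≡mod-trans (≡mod-sym c≡a) (∣⇒≡mod-0 d∣c))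
  ∣-≡± d∣c (neg c+a≡0) = ≡mod-0⇒∣ (≡mod-trans (≡mod-+ (≡mod-sym (∣⇒≡mod-0 d∣c)) ≡mod-refl) c+a≡0)

  ≡±-*-cancelʳ : ∀ c .{{_ : NonZero c}} .{{_ : NonZero (d * c)}} {a b} →
                 a * c ≡±[ d * c ] b * c → a ≡±[ d ] b
  ≡±-*-cancelʳ c (pos ac≡bc) = pos (≡mod-*-cancelʳ c ac≡bc)
  ≡±-*-cancelʳ c {a} {b} (neg ac+bc≡0) =
    neg (≡mod-*-cancelʳ c (≡mod-trans (≡⇒≡mod (*-distribʳ-+ c a b)) ac+bc≡0))

module _ {d e : ℕ} .{{_ : NonZero d}} .{{_ : NonZero e}} (d≡e : d ≡ e) where

  ≡mod-modulus : ∀ {a b} → a ≡[ d ] b → a ≡[ e ] b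
  ≡mod-modulus (mk≡mod a≡b) = mk≡mod (trans (%-congʳ (sym d≡e)) (trans a≡b (%-congʳ d≡e)))

  ≡±-modulus : ∀ {a b} → a ≡±[ d ] b → a ≡±[ e ] b
  ≡±-modulus (pos a≡b)   = pos (≡mod-modulus a≡b)
  ≡±-modulus (neg a+b≡0) = neg (≡mod-modulus a+b≡0)

pred[d]*x+x≡x*d : ∀ d .{{_ : NonZero d}} x → (d ∸ 1) * x + x ≡ x * d
pred[d]*x+x≡x*d (suc d) x = trans (+-comm (d * x) x) (*-comm (suc d) x)

≡mod-isGroup : ∀ d .{{_ : NonZero d}} → IsGroup _≡[ d ]_ _+_ 0 ((d ∸ 1) *_)
≡mod-isGroup d = record
  { isMonoid = record
    { isSemigroup = record
      { isMagma = record
        { isEquivalence = Setoid.isEquivalence (≡mod-setoid d)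
        ; ∙-cong        = ≡mod-+
        }
      ; assoc = λ x y z → ≡⇒≡mod (+-assoc x y z)
      }
    ; identity = (λ _ → ≡mod-refl) , (λ x → ≡⇒≡mod (+-identityʳ x))
    }
  ; inverse  = (λ x → ≡mod-trans (≡⇒≡mod (pred[d]*x+x≡x*d d x)) (multiple-≡mod-0 x))
             , (λ x → ≡mod-trans (≡⇒≡mod (trans (+-comm x _) (pred[d]*x+x≡x*d d x))) (multiple-≡mod-0 x))
  ; ⁻¹-cong  = ≡mod-*ˡ (d ∸ 1)
  }

prime[3] : Prime 3
prime[3] = from-yes (prime? 3)

3∣x+x⇒3∣x : ∀ {x} → 3 ∣ x + x → 3 ∣ x
3∣x+x⇒3∣x {x} 3∣x+x with euclidsLemma 2 x prime[3] (subst (3 ∣_) (cong (x +_) (sym (+-identityʳ x))) 3∣x+x)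
... | inj₂ 3∣x = 3∣x
... | inj₁ 3∣2 with ∣⇒≤ 3∣2
...   | s≤s (s≤s ())

residues-sum-3 : ∀ u v → 3 ∣ u + v → ¬ 3 ∣ v → u % 3 + v % 3 ≡ 3
residues-sum-3 u v 3∣u+v ¬3∣v = sum (m%n<n u 3) (m%n<n v 3)
  (trans (sym (%-distribˡ-+ u v 3)) (n∣m⇒m%n≡0 (u + v) 3 3∣u+v))
  (λ v%3≡0 → ¬3∣v (m%n≡0⇒n∣m v 3 v%3≡0))
  where
  sum : ∀ {i j} → i < 3 → j < 3 → (i + j) % 3 ≡ 0 → j ≢ 0 → i + j ≡ 3
  sum {0} {0} _ _ _  j≢0 = ⊥-elim (j≢0 refl)
  sum {1} {2} _ _ _  _   = refl
  sum {2} {1} _ _ _  _   = refl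
  sum {0} {1} _ _ () _
  sum {0} {2} _ _ () _
  sum {1} {0} _ _ () _
  sum {1} {1} _ _ () _
  sum {2} {0} _ _ () _
  sum {2} {2} _ _ () _
  sum {suc (suc (suc _))} (s≤s (s≤s (s≤s ())))
  sum {_} {suc (suc (suc _))} _ (s≤s (s≤s (s≤s ())))

-- Reflexive reduction and circulant graphs

SameGraph-refl : ∀ {N G} → SameGraph N G G
SameGraph-refl _ _ _ _ = (λ e → e) , (λ e → e)

SameGraph-sym : ∀ {N G H} → SameGraph N G H → SameGraph N H G
SameGraph-sym G≈H u w u<N w<N = proj₂ (G≈H u w u<N w<N) , proj₁ (G≈H u w u<N w<N)

SameGraph-trans : ∀ {N G H J} → SameGraph N G H → SameGraph N H J → SameGraph N G J
SameGraph-trans G≈H H≈J u w u<N w<N =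
  (λ e → proj₁ (H≈J u w u<N w<N) (proj₁ (G≈H u w u<N w<N) e)) ,
  (λ e → proj₂ (G≈H u w u<N w<N) (proj₂ (H≈J u w u<N w<N) e))

≡⇒SameGraph : ∀ {N A B} → A ≡ B → SameGraph N (C N A) (C N B)
≡⇒SameGraph refl = SameGraph-refl

SetEq-sym : ∀ {A B} → SetEq A B → SetEq B A
SetEq-sym A≈B a = proj₂ (A≈B a) , proj₁ (A≈B a)

SetEq-trans : ∀ {A B D} → SetEq A B → SetEq B D → SetEq A D
SetEq-trans A≈B B≈D a =
  (λ e → proj₁ (B≈D a) (proj₁ (A≈B a) e)) , (λ e → proj₂ (A≈B a) (proj₂ (B≈D a) e))

≡⇒SetEq : ∀ {A B} → A ≡ B → SetEq A B
≡⇒SetEq refl _ = (λ e → e) , (λ e → e)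

card≡length : ∀ {N X Y} → Unique Y → SetEq (redSet N X) Y → card N X ≡ length Y
card≡length {N} {X} Y! X≈Y = ↭-length (∼bag⇒↭ (unique∧set⇒bag (deduplicate-! (redSet N X)) Y!
  (mk⇔ (λ x∈ → proj₁ (X≈Y _) (Equivalence.from (deduplicate-∈⇔ _≟_) x∈))
       (λ x∈ → Equivalence.to (deduplicate-∈⇔ _≟_) (proj₂ (X≈Y _) x∈)))))

≤-by : ∀ {a b} d → a + d ≡ b → a ≤ b
≤-by {a} d a+d≡b = subst (a ≤_) a+d≡b (m≤m+n a d)

increasing⇒Unique : ∀ {xs} → Linked _<_ xs → Unique xs
increasing⇒Unique = AllPairs.map <⇒≢ ∘ Linked⇒AllPairs <-trans

IsJump : (N : ℕ) .{{_ : NonZero N}} → List ℕ → ℕ → Set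
IsJump N A v = ∃[ s ] (s ∈ A × v ≡±[ N ] s)

mod≡% : ∀ a d .{{_ : NonZero d}} → a mod d ≡ a % d
mod≡% a (suc d) = refl

module _ {N : ℕ} .{{_ : NonZero N}} where

  mod-≡mod : ∀ v → v mod N ≡[ N ] v
  mod-≡mod v = ≡mod-trans (≡⇒≡mod (mod≡% v N)) (%-≡mod v)

  mod<N : ∀ v → v mod N < N
  mod<N v = subst (_< N) (sym (mod≡% v N)) (m%n<n v N)

  N≡mod0 : N ≡[ N ] 0
  N≡mod0 = ≡mod-trans (≡⇒≡mod (sym (*-identityˡ N))) (multiple-≡mod-0 1)

  ∃-difference : ∀ u v → ∃[ c ] u + c ≡[ N ] v
  ∃-difference u v = v + (N ∸ u % N) , (begin
    u + (v + (N ∸ u % N))       ≈⟨ ≡mod-+ (%-≡mod u) ≡mod-refl ⟨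
    u % N + (v + (N ∸ u % N))   ≡⟨ x+[y+z]≡y+[x+z] (u % N) v _ ⟩
    v + (u % N + (N ∸ u % N))   ≡⟨ cong (v +_) (m+[n∸m]≡n (m%n≤n u N)) ⟩
    v + N                       ≈⟨ ≡mod-+ {a = v} ≡mod-refl N≡mod0 ⟩
    v + 0                       ≡⟨ +-identityʳ v ⟩
    v                           ∎)
    where
    open ≡mod-Reasoning N
    x+[y+z]≡y+[x+z] : ∀ x y z → x + (y + z) ≡ y + (x + z)
    x+[y+z]≡y+[x+z] = solve-∀

  red-≡± : ∀ v → red N v ≡±[ N ] v
  red-≡± v with 2 * (v mod N) ≤? N
  ... | yes _ = pos (mod-≡mod v)
  ... | no  _ = neg (begin
    N ∸ v mod N + v          ≈⟨ ≡mod-+ {a = N ∸ v mod N} ≡mod-refl (mod-≡mod v) ⟨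
    N ∸ v mod N + v mod N    ≡⟨ m∸n+n≡m (<⇒≤ (mod<N v)) ⟩
    N                        ≈⟨ N≡mod0 ⟩
    0                        ∎)
    where open ≡mod-Reasoning N

  red-bound : ∀ v → 2 * red N v ≤ N
  red-bound v with 2 * (v mod N) ≤? N
  ... | yes 2r≤N = 2r≤N
  ... | no  2r≰N = begin
    2 * (N ∸ r)   ≡⟨ *-distribˡ-∸ 2 N r ⟩
    2 * N ∸ 2 * r ≤⟨ m≤n+o⇒m∸n≤o (2 * N) (2 * r) 2N≤2r+N ⟩
    N             ∎
    where
    open ≤-Reasoning
    r = v mod N
    2N≤2r+N : 2 * N ≤ 2 * r + N
    2N≤2r+N = subst (_≤ 2 * r + N) (cong (N +_) (sym (+-identityʳ N)))
                    (+-monoˡ-≤ N (<⇒≤ (≰⇒> 2r≰N)))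

  half<N : ∀ {a} → 2 * a ≤ N → a < N
  half<N {zero}  _    = >-nonZero⁻¹ N
  half<N {suc a} 2a≤N =
    <-≤-trans (m<m+n (suc a) z<s) (subst (_≤ N) (cong (suc a +_) (+-identityʳ (suc a))) 2a≤N)

  half-≡±⇒≡ : ∀ {a b} → 2 * a ≤ N → 2 * b ≤ N → a ≡±[ N ] b → a ≡ b
  half-≡±⇒≡ 2a≤N 2b≤N (pos a≡b) = ≡mod⇒≡ (half<N 2a≤N) (half<N 2b≤N) a≡b
  half-≡±⇒≡ {a} {b} 2a≤N 2b≤N (neg a+b≡0) with m≤n⇒m<n∨m≡n a+b≤N
    where
    a+b≤N : a + b ≤ N
    a+b≤N = *-cancelˡ-≤ 2 (subst (_≤ 2 * N) (sym (*-distribˡ-+ 2 a b))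
              (subst (2 * a + 2 * b ≤_) (cong (N +_) (sym (+-identityʳ N))) (+-mono-≤ 2a≤N 2b≤N)))
  ... | inj₁ a+b<N = trans (m+n≡0⇒m≡0 a a+b=0) (sym (m+n≡0⇒n≡0 a a+b=0))
    where
    a+b=0 : a + b ≡ 0
    a+b=0 = ≡mod⇒≡ a+b<N (>-nonZero⁻¹ N) a+b≡0
  ... | inj₂ a+b≡N = ≤-antisym (double≤⇒≤ (subst (2 * a ≤_) (sym a+b≡N) 2a≤N))
                               (double≤⇒≤ (subst (2 * b ≤_) (trans (sym a+b≡N) (+-comm a b)) 2b≤N))
    where
    double≤⇒≤ : ∀ {x y} → 2 * x ≤ x + y → x ≤ y
    double≤⇒≤ {x} {y} 2x≤x+y = +-cancelˡ-≤ x x y (subst (_≤ x + y) (cong (x +_) (+-identityʳ x)) 2x≤x+y)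

  red-cong : ∀ {v w} → v ≡±[ N ] w → red N v ≡ red N w
  red-cong {v} {w} v≡±w = half-≡±⇒≡ (red-bound v) (red-bound w)
    (≡±-trans (red-≡± v) (≡±-trans v≡±w (≡±-sym (red-≡± w))))

  red-id : ∀ {s} → 2 * s ≤ N → red N s ≡ s
  red-id {s} 2s≤N = half-≡±⇒≡ (red-bound s) 2s≤N (red-≡± s)

  redSet-JumpSet : ∀ {X} → JumpSet N X → redSet N X ≡ X
  redSet-JumpSet []                 = refl
  redSet-JumpSet ((_ , 2s≤N) ∷ js) = cong₂ _∷_ (red-id 2s≤N) (redSet-JumpSet js)

  redSet-bound : ∀ {X c} → c ∈ redSet N X → 2 * c ≤ N
  redSet-bound c∈ with ∈-map⁻ (red N) c∈
  ... | s , _ , refl = red-bound s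

  red-∈-JumpSet : ∀ {A v} → JumpSet N A → IsJump N A v → red N v ∈ A
  red-∈-JumpSet {A} A-jumps (s , s∈A , v≡±s) =
    subst (_∈ A) (sym (trans (red-cong v≡±s) (red-id (proj₂ (lookup A-jumps s∈A))))) s∈A

  C-sym : ∀ {X x y} → C N X x y → C N X y x
  C-sym (s , s∈X , inj₁ x+s≡y) = s , s∈X , inj₂ x+s≡y
  C-sym (s , s∈X , inj₂ y+s≡x) = s , s∈X , inj₁ y+s≡x

  C-by-jump : ∀ {X u v s} → s ∈ X → v < N → u + s ≡[ N ] v → C N X u v
  C-by-jump {u = u} {v} {s} s∈X v<N (mk≡mod u+s≡v) =
    s , s∈X , inj₁ (trans (mod≡% (u + s) N) (trans u+s≡v (m<n⇒m%n≡m v<N)))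

  C-by-red : ∀ {X u v c} → u < N → v < N → red N c ∈ X → u + c ≡[ N ] v → C N X u v
  C-by-red {u = u} {v} {c} u<N v<N rc∈X u+c≡v with red-≡± c
  ... | pos rc≡c   = C-by-jump rc∈X v<N (≡mod-trans (≡mod-+ {a = u} ≡mod-refl rc≡c) u+c≡v)
  ... | neg rc+c≡0 = C-sym (C-by-jump rc∈X u<N (begin
    v + red N c         ≈⟨ ≡mod-+ u+c≡v ≡mod-refl ⟨
    u + c + red N c     ≡⟨ +-assoc u c (red N c) ⟩
    u + (c + red N c)   ≡⟨ cong (u +_) (+-comm c (red N c)) ⟩
    u + (red N c + c)   ≈⟨ ≡mod-+ {a = u} ≡mod-refl rc+c≡0 ⟩
    u + 0               ≡⟨ +-identityʳ u ⟩
    u                   ∎))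
    where open ≡mod-Reasoning N

  C₀⇒≡± : ∀ {X y} → C N X 0 y → ∃[ s ] (s ∈ X × y ≡±[ N ] s)
  C₀⇒≡± (s , s∈X , inj₁ s≡y) =
    s , s∈X , pos (≡mod-trans (≡⇒≡mod (sym s≡y)) (mod-≡mod s))
  C₀⇒≡± {y = y} (s , s∈X , inj₂ y+s≡0) =
    s , s∈X , neg (≡mod-trans (≡mod-sym (mod-≡mod (y + s))) (≡⇒≡mod y+s≡0))

  ≡±⇒C₀ : ∀ {X y s} → y < N → s ∈ X → y ≡±[ N ] s → C N X 0 y
  ≡±⇒C₀ y<N s∈X (pos y≡s)   = C-by-jump s∈X y<N (≡mod-sym y≡s)
  ≡±⇒C₀ y<N s∈X (neg y+s≡0) = C-sym (C-by-jump s∈X (>-nonZero⁻¹ N) y+s≡0)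

  C₀-≡± : ∀ {X v w} → v < N → v ≡±[ N ] w → C N X 0 w → C N X 0 v
  C₀-≡± v<N v≡±w C0w with C₀⇒≡± C0w
  ... | s , s∈X , w≡±s = ≡±⇒C₀ v<N s∈X (≡±-trans v≡±w w≡±s)

  ∈redSet⇒C₀ : ∀ {X c} → c ∈ redSet N X → C N X 0 c
  ∈redSet⇒C₀ c∈ with ∈-map⁻ (red N) c∈
  ... | s , s∈X , refl = ≡±⇒C₀ (half<N (red-bound s)) s∈X (red-≡± s)

  C₀⇒∈redSet : ∀ {X c} → 2 * c ≤ N → C N X 0 c → c ∈ redSet N X
  C₀⇒∈redSet 2c≤N C0c with C₀⇒≡± C0c
  ... | s , s∈X , c≡±s =
    subst (_∈ _) (trans (red-cong (≡±-sym c≡±s)) (red-id 2c≤N)) (∈-map⁺ (red N) s∈X)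

  SameGraph⇒SetEq : ∀ {X Y} → SameGraph N (C N X) (C N Y) → SetEq (redSet N X) (redSet N Y)
  SameGraph⇒SetEq X≈Y c = transfer X≈Y , transfer (SameGraph-sym X≈Y)
    where
    transfer : ∀ {X Y} → SameGraph N (C N X) (C N Y) → c ∈ redSet N X → c ∈ redSet N Y
    transfer X≈Y c∈ = C₀⇒∈redSet (redSet-bound c∈)
      (proj₁ (X≈Y 0 c (>-nonZero⁻¹ N) (half<N (redSet-bound c∈))) (∈redSet⇒C₀ c∈))

-- The maps θ_{N,m,t}

module Shift {N m M : ℕ} .{{_ : NonZero N}} .{{_ : NonZero m}} (M*m≡N : M * m ≡ N) where

  m∣N : m ∣ N
  m∣N = divides M (sym M*m≡N)

  θ-≡ : ∀ t x → θ N m t x ≡[ N ] x + x % m * m * t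
  θ-≡ t x = ≡mod-trans (mod-≡mod (x + x mod m * m * t))
                       (≡⇒≡mod (cong (λ j → x + j * m * t) (mod≡% x m)))

  θ<N : ∀ t x → θ N m t x < N
  θ<N t x = mod<N (x + x mod m * m * t)

  θ-%m : ∀ t x → θ N m t x % m ≡ x % m
  θ-%m t x = %≡% (begin
    θ N m t x           ≈⟨ ≡mod-∣ m∣N (θ-≡ t x) ⟩
    x + x % m * m * t   ≡⟨ cong (x +_) (swap (x % m) m t) ⟩
    x + x % m * t * m   ≈⟨ +-multiple-≡mod x (x % m * t) ⟩
    x                   ∎)
    where
    open ≡mod-Reasoning m
    swap : ∀ j m t → j * m * t ≡ j * t * m
    swap = solve-∀

  θ-zero : ∀ t → θ N m t 0 ≡ 0
  θ-zero t = ≡mod⇒≡ (θ<N t 0) (>-nonZero⁻¹ N) (begin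
    θ N m t 0           ≈⟨ θ-≡ t 0 ⟩
    0 % m * m * t       ≡⟨ cong (λ j → j * m * t) 0%d ⟩
    0                   ∎)
    where open ≡mod-Reasoning N

  θ-∘ : ∀ t t′ x → θ N m t (θ N m t′ x) ≡ θ N m (t′ + t) x
  θ-∘ t t′ x = ≡mod⇒≡ (θ<N t _) (θ<N (t′ + t) x) (begin
    θ N m t y                      ≈⟨ θ-≡ t y ⟩
    y + y % m * m * t              ≡⟨ cong (λ j → y + j * m * t) (θ-%m t′ x) ⟩
    y + j * m * t                  ≈⟨ ≡mod-+ (θ-≡ t′ x) ≡mod-refl ⟩
    x + j * m * t′ + j * m * t     ≡⟨ +-assoc x _ _ ⟩
    x + (j * m * t′ + j * m * t)   ≡⟨ cong (x +_) (*-distribˡ-+ (j * m) t′ t) ⟨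
    x + j * m * (t′ + t)           ≈⟨ θ-≡ (t′ + t) x ⟨
    θ N m (t′ + t) x               ∎)
    where
    open ≡mod-Reasoning N
    y = θ N m t′ x
    j = x % m

  θ-period : ∀ c t x → θ N m (t + c * M) x ≡ θ N m t x
  θ-period c t x = ≡mod⇒≡ (θ<N _ x) (θ<N t x) (begin
    θ N m (t + c * M) x                   ≈⟨ θ-≡ (t + c * M) x ⟩
    x + j * m * (t + c * M)               ≡⟨ expand x j m t c M ⟩
    x + j * m * t + j * c * (M * m)       ≡⟨ cong (λ z → x + j * m * t + j * c * z) M*m≡N ⟩
    x + j * m * t + j * c * N             ≈⟨ +-multiple-≡mod (x + j * m * t) (j * c) ⟩
    x + j * m * t                         ≈⟨ θ-≡ t x ⟨
    θ N m t x                             ∎)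
    where
    open ≡mod-Reasoning N
    j = x % m
    expand : ∀ x j m t c M → x + j * m * (t + c * M) ≡ x + j * m * t + j * c * (M * m)
    expand = solve-∀

  θ-0 : ∀ {x} → x < N → θ N m 0 x ≡ x
  θ-0 {x} x<N = ≡mod⇒≡ (θ<N 0 x) x<N
    (≡mod-trans (θ-≡ 0 x) (≡⇒≡mod (trans (cong (x +_) (*-zeroʳ (x % m * m))) (+-identityʳ x))))

  θ≡0⇒≡0 : ∀ {t x} → x < N → θ N m t x ≡ 0 → x ≡ 0
  θ≡0⇒≡0 {t} {x} x<N θx≡0 = ≡mod⇒≡ x<N (>-nonZero⁻¹ N) (begin
    x                     ≡⟨ +-identityʳ x ⟨
    x + 0 * m * t         ≡⟨ cong (λ j → x + j * m * t) j≡0 ⟨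
    x + x % m * m * t     ≈⟨ θ-≡ t x ⟨
    θ N m t x             ≡⟨ θx≡0 ⟩
    0                     ∎)
    where
    open ≡mod-Reasoning N
    j≡0 : x % m ≡ 0
    j≡0 = trans (sym (θ-%m t x)) (trans (cong (_% m) θx≡0) 0%d)

  Maps : ℕ → List ℕ → List ℕ → Set
  Maps t A B = ∀ {x y} → x < N → y < N → C N A x y → C N B (θ N m t x) (θ N m t y)

  maps-id : ∀ {A} → Maps 0 A A
  maps-id {A} x<N y<N Cxy = subst₂ (C N A) (sym (θ-0 x<N)) (sym (θ-0 y<N)) Cxy

  maps-∘ : ∀ {t t′ A B D} → Maps t A B → Maps t′ B D → Maps (t + t′) A D
  maps-∘ {t} {t′} {D = D} f g {x} {y} x<N y<N Cxy =
    subst₂ (C N D) (θ-∘ t′ t x) (θ-∘ t′ t y) (g (θ<N t x) (θ<N t y) (f x<N y<N Cxy))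

  maps-by-jumps : ∀ {t A B} →
                  (∀ {x s} → x < N → s ∈ A → C N B (θ N m t x) (θ N m t ((x + s) % N))) →
                  Maps t A B
  maps-by-jumps {t} {B = B} jump {x} {y} x<N y<N (s , s∈A , inj₁ x+s≡y) =
    subst (λ z → C N B (θ N m t x) (θ N m t z)) (trans (sym (mod≡% (x + s) N)) x+s≡y) (jump x<N s∈A)
  maps-by-jumps {t} {B = B} jump {x} {y} x<N y<N (s , s∈A , inj₂ y+s≡x) =
    C-sym (subst (λ z → C N B (θ N m t y) (θ N m t z)) (trans (sym (mod≡% (y + s) N)) y+s≡x)
                 (jump y<N s∈A))

  image-≈ : ∀ {t t′ A B} c → Maps t A B → Maps t′ B A → t′ + t ≡ c * M →
            SameGraph N (Image N m t A) (C N B)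
  image-≈ {t} {t′} {A} {B} c f g t′+t≡cM u w u<N w<N = to , from
    where
    back : ∀ {u} → u < N → θ N m t (θ N m t′ u) ≡ u
    back {u} u<N = begin
      θ N m t (θ N m t′ u)  ≡⟨ θ-∘ t t′ u ⟩
      θ N m (t′ + t) u      ≡⟨ cong (λ s → θ N m s u) t′+t≡cM ⟩
      θ N m (0 + c * M) u   ≡⟨ θ-period c 0 u ⟩
      θ N m 0 u             ≡⟨ θ-0 u<N ⟩
      u                     ∎
      where open ≡-Reasoning
    to : Image N m t A u w → C N B u w
    to (x , y , x<N , y<N , Cxy , θx≡u , θy≡w) = subst₂ (C N B) θx≡u θy≡w (f x<N y<N Cxy)
    from : C N B u w → Image N m t A u w
    from Cuw = θ N m t′ u , θ N m t′ w , θ<N t′ u , θ<N t′ w , g u<N w<N Cuw , back u<N , back w<N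

  image-mod : ∀ {t A} .{{_ : NonZero M}} → SameGraph N (Image N m (t % M) A) (Image N m t A)
  image-mod {t} {A} u w _ _ = transport θt≡θt%M , transport (sym ∘ θt≡θt%M)
    where
    θt≡θt%M : ∀ x → θ N m t x ≡ θ N m (t % M) x
    θt≡θt%M x = trans (cong (λ s → θ N m s x) (m≡m%n+[m/n]*n t M)) (θ-period (t / M) (t % M) x)
    transport : ∀ {s s′} → (∀ x → θ N m s x ≡ θ N m s′ x) → Image N m s′ A u w → Image N m s A u w
    transport eq (x , y , x<N , y<N , Cxy , θx≡u , θy≡w) =
      x , y , x<N , y<N , Cxy , trans (eq x) θx≡u , trans (eq y) θy≡w

  circulant-image-mirror : ∀ {t A X s₁} → s₁ ∈ A → s₁ < N → SameGraph N (Image N m t A) (C N X) →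
                   ∃[ y ] ∃[ s ] (s ∈ A × y ≡±[ N ] s × θ N m t y + θ N m t s₁ ≡[ N ] 0)
  circulant-image-mirror {t} {A} {X} {s₁} s₁∈A s₁<N A≈X =
    preimage (proj₂ (A≈X 0 v 0<N v<N) (C₀-≡± v<N v≡±w C0w))
    where
    0<N = >-nonZero⁻¹ N
    w = θ N m t s₁
    c = proj₁ (∃-difference {N = N} w 0)
    v = c % N
    v<N = m%n<n c N
    v+w≡0 : v + w ≡[ N ] 0
    v+w≡0 = ≡mod-trans (≡mod-+ (%-≡mod c) ≡mod-refl)
              (≡mod-trans (≡⇒≡mod (+-comm c w)) (proj₂ (∃-difference w 0)))
    v≡±w : v ≡±[ N ] w
    v≡±w = neg v+w≡0
    C0w : C N X 0 w
    C0w = proj₁ (A≈X 0 w 0<N (θ<N t s₁))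
                (0 , s₁ , 0<N , s₁<N , C-by-jump s₁∈A s₁<N ≡mod-refl , θ-zero t , refl)
    preimage : Image N m t A 0 v → ∃[ y ] ∃[ s ] (s ∈ A × y ≡±[ N ] s × θ N m t y + w ≡[ N ] 0)
    preimage (x , y , x<N , _ , Cxy , θx≡0 , θy≡v)
      with C₀⇒≡± (subst (λ z → C N A z y) (θ≡0⇒≡0 x<N θx≡0) Cxy)
    ... | s , s∈A , y≡±s = y , s , s∈A , y≡±s , subst (λ z → z + w ≡[ N ] 0) (sym θy≡v) v+w≡0


-- Jump sets made of ±a modulo M = N/3, together with the jump 3

module Orbits {N M : ℕ} .{{_ : NonZero N}} .{{_ : NonZero M}} (M*3≡N : M * 3 ≡ N) (3∣M : 3 ∣ M) where

  open Shift {N} {3} {M} M*3≡N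

  private instance
    M*3≢0 : NonZero (M * 3)
    M*3≢0 = m*n≢0 M 3

  M∣N : M ∣ N
  M∣N = divides 3 (trans (sym M*3≡N) (*-comm M 3))

  3∣N : 3 ∣ N
  3∣N = ∣-trans 3∣M M∣N

  -- Reduced modulo N, A is {3} ∪ {c : c ≡ ±a (mod M)}.
  record IsOrbitOf (A : List ℕ) (a : ℕ) : Set where
    field
      sound    : All (λ s → s ≡ 3 ⊎ s ≡±[ M ] a) A
      complete : ∀ c → c ≡[ M ] a → red N c ∈ A

  open IsOrbitOf public

  ¬3∣-≡± : ∀ {a c} → ¬ 3 ∣ a → c ≡±[ M ] a → ¬ 3 ∣ c
  ¬3∣-≡± ¬3∣a c≡±a 3∣c = ¬3∣a (∣-≡± 3∣c (≡±-∣ 3∣M c≡±a))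

  red≡±[M] : ∀ v → red N v ≡±[ M ] v
  red≡±[M] v = ≡±-∣ M∣N (red-≡± v)

  IsOrbitOf-cong : ∀ {A a b} → IsOrbitOf A a → a ≡[ M ] b → IsOrbitOf A b
  IsOrbitOf-cong A-orb a≡b = record
    { sound    = All.map (Sum.map₂ (λ s≡±a → ≡±-trans s≡±a (pos a≡b))) (sound A-orb)
    ; complete = λ c c≡b → complete A-orb c (≡mod-trans c≡b (≡mod-sym a≡b))
    }

  complete± : ∀ {A a} → IsOrbitOf A a → ∀ {c} → c ≡±[ M ] a → red N c ∈ A
  complete± A-orb {c} (pos c≡a) = complete A-orb c c≡a
  complete± {A} {a} A-orb {c} (neg c+a≡0) =
    subst (_∈ A) (red-cong (neg c′+c≡0)) (complete A-orb c′ c′≡a)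
    where
    c′ = proj₁ (∃-difference {N = N} c 0)
    c′+c≡0 : c′ + c ≡[ N ] 0
    c′+c≡0 = ≡mod-trans (≡⇒≡mod (+-comm c′ c)) (proj₂ (∃-difference c 0))
    c′≡a : c′ ≡[ M ] a
    c′≡a = ≡mod-cancelʳ-+ c (≡mod-trans (≡mod-∣ M∣N c′+c≡0)
                                        (≡mod-sym (≡mod-trans (≡⇒≡mod (+-comm a c)) c+a≡0)))

  complete-by-three : ∀ {A a} → JumpSet N A → a < M →
                      IsJump N A a → IsJump N A (a + M) → IsJump N A (a + 2 * M) →
                      ∀ c → c ≡[ M ] a → red N c ∈ A
  complete-by-three {A} {a} A-jumps a<M a∈ a+M∈ a+2M∈ c c≡a =
    subst (_∈ A) (red-cong (pos (≡mod-trans (≡⇒≡mod (sym c%N≡a+qM)) (%-≡mod c))))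
                 (red-∈-JumpSet A-jumps (by-q q<3))
    where
    q = (c % N) / M
    q<3 : q < 3
    q<3 = m<n*o⇒m/o<n (subst (c % N <_) (trans (sym M*3≡N) (*-comm M 3)) (m%n<n c N))
    c%N≡a+qM : c % N ≡ a + q * M
    c%N≡a+qM = begin
      c % N               ≡⟨ m≡m%n+[m/n]*n (c % N) M ⟩
      c % N % M + q * M   ≡⟨ cong (_+ q * M) (m∣n⇒o%n%m≡o%m M N c M∣N) ⟩
      c % M + q * M       ≡⟨ cong (_+ q * M) (trans (%≡% c≡a) (m<n⇒m%n≡m a<M)) ⟩
      a + q * M           ∎
      where open ≡-Reasoning
    by-q : ∀ {q} → q < 3 → IsJump N A (a + q * M)
    by-q {0}                 _ = subst (IsJump N A) (sym (+-identityʳ a)) a∈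
    by-q {1}                 _ = subst (λ x → IsJump N A (a + x)) (sym (+-identityʳ M)) a+M∈
    by-q {2}                 _ = a+2M∈
    by-q {suc (suc (suc _))} (s≤s (s≤s (s≤s ())))

  residue-scale : ∀ {t} → M ∣ 9 * t → ∀ u → u % 3 * 3 * t ≡[ M ] u * 3 * t
  residue-scale {t} M∣9t u = begin
    u % 3 * 3 * t                   ≡⟨ +-identityʳ _ ⟨
    u % 3 * 3 * t + 0               ≈⟨ ≡mod-+ {a = u % 3 * 3 * t} ≡mod-refl q9t≡0 ⟨
    u % 3 * 3 * t + u / 3 * (9 * t) ≡⟨ regroup (u % 3) (u / 3) t ⟩
    (u % 3 + u / 3 * 3) * 3 * t     ≡⟨ cong (λ x → x * 3 * t) (m≡m%n+[m/n]*n u 3) ⟨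
    u * 3 * t                       ∎
    where
    open ≡mod-Reasoning M
    q9t≡0 : u / 3 * (9 * t) ≡[ M ] 0
    q9t≡0 = ≡mod-trans (≡mod-*ˡ (u / 3) (∣⇒≡mod-0 M∣9t)) (≡⇒≡mod (*-zeroʳ (u / 3)))
    regroup : ∀ r q t → r * 3 * t + q * (9 * t) ≡ (r + q * 3) * 3 * t
    regroup = solve-∀

  θ-≡-scale : ∀ {t} → M ∣ 9 * t → ∀ x → θ N 3 t x ≡[ M ] (1 + 3 * t) * x
  θ-≡-scale {t} M∣9t x = begin
    θ N 3 t x             ≈⟨ ≡mod-∣ M∣N (θ-≡ t x) ⟩
    x + x % 3 * 3 * t     ≈⟨ ≡mod-+ {a = x} ≡mod-refl (residue-scale M∣9t x) ⟩
    x + x * 3 * t         ≡⟨ factor x t ⟩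
    (1 + 3 * t) * x       ∎
    where
    open ≡mod-Reasoning M
    factor : ∀ x t → x + x * 3 * t ≡ (1 + 3 * t) * x
    factor = solve-∀

  θ-jump-≡ : ∀ {t} → M ∣ 9 * t → ∀ x s {c} → θ N 3 t x + c ≡[ N ] θ N 3 t ((x + s) % N) →
             c ≡[ M ] (1 + 3 * t) * s
  θ-jump-≡ {t} M∣9t x s {c} θx+c≡θy = ≡mod-cancelʳ-+ ((1 + 3 * t) * x) (begin
    c + (1 + 3 * t) * x                   ≈⟨ ≡mod-+ {a = c} ≡mod-refl (θ-≡-scale M∣9t x) ⟨
    c + θ N 3 t x                         ≡⟨ +-comm c _ ⟩
    θ N 3 t x + c                         ≈⟨ ≡mod-∣ M∣N θx+c≡θy ⟩
    θ N 3 t ((x + s) % N)                 ≈⟨ θ-≡-scale M∣9t ((x + s) % N) ⟩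
    (1 + 3 * t) * ((x + s) % N)           ≈⟨ ≡mod-*ˡ (1 + 3 * t) (≡mod-∣ M∣N (%-≡mod (x + s))) ⟩
    (1 + 3 * t) * (x + s)                 ≡⟨ distrib (1 + 3 * t) x s ⟩
    (1 + 3 * t) * s + (1 + 3 * t) * x     ∎)
    where
    open ≡mod-Reasoning M
    distrib : ∀ k x s → k * (x + s) ≡ k * s + k * x
    distrib = solve-∀

  θ-jump-3 : ∀ t x → θ N 3 t x + 3 ≡[ N ] θ N 3 t ((x + 3) % N)
  θ-jump-3 t x = begin
    θ N 3 t x + 3           ≈⟨ ≡mod-+ (θ-≡ t x) ≡mod-refl ⟩
    x + j * 3 * t + 3       ≡⟨ swap x (j * 3 * t) ⟩
    x + 3 + j * 3 * t       ≈⟨ ≡mod-+ (%-≡mod (x + 3)) ≡mod-refl ⟨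
    y + j * 3 * t           ≡⟨ cong (λ i → y + i * 3 * t) y%3≡j ⟨
    y + y % 3 * 3 * t       ≈⟨ θ-≡ t y ⟨
    θ N 3 t y               ∎
    where
    open ≡mod-Reasoning N
    j = x % 3
    y = (x + 3) % N
    y%3≡j : y % 3 ≡ j
    y%3≡j = trans (m∣n⇒o%n%m≡o%m 3 N (x + 3) 3∣N) ([m+n]%n≡m%n x 3)
    swap : ∀ x a → x + a + 3 ≡ x + 3 + a
    swap = solve-∀

  orbit-maps : ∀ {t A B a b} → IsOrbitOf A a → IsOrbitOf B b → 3 ∈ B →
               M ∣ 9 * t → b ≡[ M ] (1 + 3 * t) * a → Maps t A B
  orbit-maps {t} {A} {B} {a} {b} A-orb B-orb 3∈B M∣9t b≡ka = maps-by-jumps jump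
    where
    jump : ∀ {x s} → x < N → s ∈ A → C N B (θ N 3 t x) (θ N 3 t ((x + s) % N))
    jump {x} {s} x<N s∈A with lookup (sound A-orb) s∈A
    ... | inj₁ refl  = C-by-jump 3∈B (θ<N t ((x + 3) % N)) (θ-jump-3 t x)
    ... | inj₂ s≡±a = C-by-red (θ<N t x) (θ<N t ((x + s) % N)) (complete± B-orb c≡±b) θx+c≡θy
      where
      c = proj₁ (∃-difference {N = N} (θ N 3 t x) (θ N 3 t ((x + s) % N)))
      θx+c≡θy = proj₂ (∃-difference {N = N} (θ N 3 t x) (θ N 3 t ((x + s) % N)))
      c≡±b : c ≡±[ M ] b
      c≡±b = ≡±-trans (pos (θ-jump-≡ M∣9t x s θx+c≡θy))
                      (≡±-trans (≡±-*ˡ (1 + 3 * t) s≡±a) (pos (≡mod-sym b≡ka)))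

  θ-sum≡0⇒N∣ : ∀ {t y s₁} → ¬ 3 ∣ s₁ → θ N 3 t y + θ N 3 t s₁ ≡[ N ] 0 → N ∣ y + s₁ + 9 * t
  θ-sum≡0⇒N∣ {t} {y} {s₁} ¬3∣s₁ θy+θs₁≡0 = subst (λ r → N ∣ y + s₁ + r * 3 * t) residues≡3 N∣Z
    where
    regroup : ∀ y s a b t → y + a * 3 * t + (s + b * 3 * t) ≡ y + s + (a + b) * 3 * t
    regroup = solve-∀
    N∣Z : N ∣ y + s₁ + (y % 3 + s₁ % 3) * 3 * t
    N∣Z = ≡mod-0⇒∣ (begin
      y + s₁ + (y % 3 + s₁ % 3) * 3 * t              ≡⟨ regroup y s₁ (y % 3) (s₁ % 3) t ⟨
      y + y % 3 * 3 * t + (s₁ + s₁ % 3 * 3 * t)      ≈⟨ ≡mod-+ (θ-≡ t y) (θ-≡ t s₁) ⟨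
      θ N 3 t y + θ N 3 t s₁                         ≈⟨ θy+θs₁≡0 ⟩
      0                                              ∎)
      where open ≡mod-Reasoning N
    3∣y+s₁ : 3 ∣ y + s₁
    3∣y+s₁ = ∣m+n∣m⇒∣n (subst (3 ∣_) (+-comm (y + s₁) _) (∣-trans 3∣N N∣Z))
                       (∣m⇒∣m*n t (∣n⇒∣m*n (y % 3 + s₁ % 3) ∣-refl))
    residues≡3 : y % 3 + s₁ % 3 ≡ 3
    residues≡3 = residues-sum-3 y s₁ 3∣y+s₁ ¬3∣s₁

  ¬3≡±[M] : ∀ {a} → ¬ 3 ∣ a → ¬ 3 ≡±[ M ] a
  ¬3≡±[M] ¬3∣a 3≡±a = ¬3∣-≡± ¬3∣a 3≡±a ∣-refl

  orbit-of-member : ∀ {B b a r} → IsOrbitOf B b → ¬ 3 ∣ a → r ∈ B → r ≡±[ M ] a → a ≡±[ M ] b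
  orbit-of-member B-orb ¬3∣a r∈B r≡±a with lookup (sound B-orb) r∈B
  ... | inj₁ refl  = ⊥-elim (¬3≡±[M] ¬3∣a r≡±a)
  ... | inj₂ r≡±b = ≡±-trans (≡±-sym r≡±a) r≡±b

  -- The mirror image of the edge 0 — θ(s₁) pulls back to an edge 0 — y of C_N(A). Residues
  -- mod 3 rule out y ≡ ±3 and y ≡ s₁ (mod M), so y + s₁ ≡ 0 (mod M) while y + s₁ + 9t ≡ 0 (mod N).
  circulant-image⇒M∣9t : ∀ {t A a X} → IsOrbitOf A a → ¬ 3 ∣ a →
                         SameGraph N (Image N 3 t A) (C N X) → M ∣ 9 * t
  circulant-image⇒M∣9t {t} {A} {a} A-orb ¬3∣a A≈X =
    conclude (circulant-image-mirror s₁∈A (half<N (red-bound a)) A≈X)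
    where
    s₁ = red N a
    s₁∈A : s₁ ∈ A
    s₁∈A = complete A-orb a ≡mod-refl
    ¬3∣s₁ : ¬ 3 ∣ s₁
    ¬3∣s₁ = ¬3∣-≡± ¬3∣a (red≡±[M] a)
    conclude : ∃[ y ] ∃[ s ] (s ∈ A × y ≡±[ N ] s × θ N 3 t y + θ N 3 t s₁ ≡[ N ] 0) → M ∣ 9 * t
    conclude (y , s , s∈A , y≡±s , θy+θs₁≡0) = by-sound (lookup (sound A-orb) s∈A)
      where
      N∣Z : N ∣ y + s₁ + 9 * t
      N∣Z = θ-sum≡0⇒N∣ {t} {y} ¬3∣s₁ θy+θs₁≡0
      3∣y+s₁ : 3 ∣ y + s₁
      3∣y+s₁ = ∣m+n∣m⇒∣n (subst (3 ∣_) (+-comm (y + s₁) (9 * t)) (∣-trans 3∣N N∣Z))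
                         (∣m⇒∣m*n t (divides 3 refl))
      by-sound : s ≡ 3 ⊎ s ≡±[ M ] a → M ∣ 9 * t
      by-sound (inj₁ refl) =
        ⊥-elim (¬3∣s₁ (∣m+n∣m⇒∣n 3∣y+s₁ (∣-≡± ∣-refl (≡±-sym (≡±-∣ 3∣N y≡±s)))))
      by-sound (inj₂ s≡±a) with ≡±-trans (≡±-∣ M∣N y≡±s) (≡±-trans s≡±a (≡±-sym (red≡±[M] a)))
      ... | pos y≡s₁   = ⊥-elim (¬3∣s₁ (3∣x+x⇒3∣x (≡mod-0⇒∣ s₁+s₁≡0)))
        where
        s₁+s₁≡0 : s₁ + s₁ ≡[ 3 ] 0
        s₁+s₁≡0 = ≡mod-trans (≡mod-+ (≡mod-sym (≡mod-∣ 3∣M y≡s₁)) ≡mod-refl) (∣⇒≡mod-0 3∣y+s₁)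
      ... | neg y+s₁≡0 = ∣m+n∣m⇒∣n (∣-trans M∣N N∣Z) (≡mod-0⇒∣ y+s₁≡0)

  SetEq⇒orbits-≡± : ∀ {A B a b} → IsOrbitOf A a → IsOrbitOf B b → ¬ 3 ∣ a → SetEq A B →
                    a ≡±[ M ] b
  SetEq⇒orbits-≡± {a = a} A-orb B-orb ¬3∣a A≈B =
    orbit-of-member B-orb ¬3∣a (proj₁ (A≈B (red N a)) (complete A-orb a ≡mod-refl)) (red≡±[M] a)

  -- x sends some s ∈ A to ±3; then s = 3, so x ≡ ±1 (mod M) and x fixes the orbit of a.
  ¬SetEq-scale : ∀ {A B a b x} → IsOrbitOf A a → IsOrbitOf B b → ¬ 3 ∣ a → 3 ∈ B →
                 ¬ a ≡±[ M ] b → Coprime x N → ¬ SetEq B (scale N x A)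
  ¬SetEq-scale {A} {B} {a} {b} {x} A-orb B-orb ¬3∣a 3∈B a≢±b x⊥N B≈xA =
    a≢±b (orbit-of-member B-orb ¬3∣a (proj₂ (B≈xA r) r∈xA) r≡±a)
    where
    s₁ = red N a
    r = red N (x * s₁)
    r∈xA : r ∈ scale N x A
    r∈xA = ∈-map⁺ (red N) (∈-map⁺ (x *_) (complete A-orb a ≡mod-refl))
    ¬3∣x : ¬ 3 ∣ x
    ¬3∣x 3∣x with x⊥N (3∣x , 3∣N)
    ... | ()
    x≡±1 : ∃[ v ] (v ∈ map (x *_) A × 3 ≡ red N v) → x ≡±[ M ] 1
    x≡±1 (v , v∈xA , 3≡rv) with ∈-map⁻ (x *_) v∈xA
    ... | s , s∈A , refl with lookup (sound A-orb) s∈A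
    ...   | inj₁ refl  = ≡±-*-cancelʳ 3 (≡±-modulus (sym M*3≡N) (≡±-sym 3≡±3x))
      where
      3≡±3x : 3 ≡±[ N ] x * 3
      3≡±3x = subst (_≡±[ N ] x * 3) (sym 3≡rv) (red-≡± (x * 3))
    ...   | inj₂ s≡±a = ⊥-elim (¬3∣-≡± ¬3∣a s≡±a 3∣s)
      where
      3∣xs : 3 ∣ x * s
      3∣xs = ∣-≡± ∣-refl (≡±-∣ 3∣N (subst (_≡±[ N ] x * s) (sym 3≡rv) (red-≡± (x * s))))
      3∣s : 3 ∣ s
      3∣s with euclidsLemma x s prime[3] 3∣xs
      ... | inj₁ 3∣x = ⊥-elim (¬3∣x 3∣x)
      ... | inj₂ 3∣s = 3∣s
    r≡±a : r ≡±[ M ] a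
    r≡±a = ≡±-trans (red≡±[M] (x * s₁)) (≡±-trans xs₁≡±s₁ (red≡±[M] a))
      where
      xs₁≡±s₁ : x * s₁ ≡±[ M ] s₁
      xs₁≡±s₁ = subst (x * s₁ ≡±[ M ]_) (*-identityˡ s₁)
                      (≡±-*ʳ s₁ (x≡±1 (∈-map⁻ (red N) (proj₁ (B≈xA 3) 3∈B))))


-- The jump sets R, S, T for N = 27n

module Jumps27n (k : ℕ) where

  -- Inlined so that the ring solver sees polynomials in k; it also needs the variable list [k]
  -- under a name, since the literal k ∷ [] is ambiguous between the list and All constructors.
  n N M : ℕ
  n = suc k
  N = 27 * suc k
  M = 9 * suc k
  {-# INLINE n #-}
  {-# INLINE N #-}
  {-# INLINE M #-}

  [k] : List ℕ
  [k] = k ∷ []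

  M*3≡N : M * 3 ≡ N
  M*3≡N = solve [k]

  3∣M : 3 ∣ M
  3∣M = divides (3 * n) (solve [k])

  open Shift {N} {3} {M} M*3≡N
  open Orbits {N} {M} M*3≡N 3∣M

  -- With n = k + 1, c * n ∸ 1 unfolds to k + (c ∸ 1) * n: these are the lists of the statement.
  R S T : List ℕ
  R = 1 ∷ 3 ∷ k + 8 * n ∷ 9 * n + 1 ∷ []
  S = 3 ∷ 3 * n + 1 ∷ k + 5 * n ∷ 12 * n + 1 ∷ []
  T = 3 ∷ k + 2 * n ∷ 6 * n + 1 ∷ k + 11 * n ∷ []

  R-jumps : JumpSet N R
  R-jumps = (≤-by 0 refl , ≤-by (27 * k + 25) (solve [k]))
          ∷ (≤-by 2 refl , ≤-by (27 * k + 21) (solve [k]))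
          ∷ (≤-by (9 * k + 7) (solve [k]) , ≤-by (9 * k + 11) (solve [k]))
          ∷ (≤-by (9 * k + 9) (solve [k]) , ≤-by (9 * k + 7) (solve [k]))
          ∷ []

  S-jumps : JumpSet N S
  S-jumps = (≤-by 2 refl , ≤-by (27 * k + 21) (solve [k]))
          ∷ (≤-by (3 * k + 3) (solve [k]) , ≤-by (21 * k + 19) (solve [k]))
          ∷ (≤-by (6 * k + 4) (solve [k]) , ≤-by (15 * k + 17) (solve [k]))
          ∷ (≤-by (12 * k + 12) (solve [k]) , ≤-by (3 * k + 1) (solve [k]))
          ∷ []

  T-jumps : JumpSet N T
  T-jumps = (≤-by 2 refl , ≤-by (27 * k + 21) (solve [k]))
          ∷ (≤-by (3 * k + 1) (solve [k]) , ≤-by (21 * k + 23) (solve [k]))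
          ∷ (≤-by (6 * k + 6) (solve [k]) , ≤-by (15 * k + 13) (solve [k]))
          ∷ (≤-by (12 * k + 10) (solve [k]) , ≤-by (3 * k + 5) (solve [k]))
          ∷ []

  R-unique : Unique R
  R-unique = increasing⇒Unique
    (≤-by 1 refl ∷ ≤-by (9 * k + 4) (solve [k]) ∷ ≤-by 1 (solve [k]) ∷ [-])

  S-unique : Unique S
  S-unique = increasing⇒Unique
    (≤-by (3 * k) (solve [k]) ∷ ≤-by (3 * k) (solve [k]) ∷ ≤-by (6 * k + 7) (solve [k]) ∷ [-])

  T-unique : Unique T
  T-unique = (3≢3n∸1 ∷ <⇒≢ 3<6n+1 ∷ <⇒≢ 3<12n∸1 ∷ [])
           ∷ increasing⇒Unique (≤-by (3 * k + 4) (solve [k]) ∷ ≤-by (6 * k + 3) (solve [k]) ∷ [-])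
    where
    3n∸1≡2+3k : k + 2 * n ≡ 2 + k * 3
    3n∸1≡2+3k = solve [k]
    3≢3n∸1 : 3 ≢ k + 2 * n
    3≢3n∸1 3≡3n∸1 with trans (cong (_% 3) (trans 3≡3n∸1 3n∸1≡2+3k)) ([m+kn]%n≡m%n 2 k 3)
    ... | ()
    3<6n+1 : 3 < 6 * n + 1
    3<6n+1 = ≤-by (6 * k + 3) (solve [k])
    3<12n∸1 : 3 < k + 11 * n
    3<12n∸1 = ≤-by (12 * k + 7) (solve [k])

  R-orbit : IsOrbitOf R 1
  R-orbit = record
    { sound    = inj₂ (pos ≡mod-refl) ∷ inj₁ refl
                 ∷ inj₂ (neg-by 1 (solve [k])) ∷ inj₂ (pos-by 1 (solve [k])) ∷ []
    ; complete = complete-by-three R-jumps (≤-by (9 * k + 7) (solve [k]))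
        (1         , here refl                         , pos ≡mod-refl)
        (9 * n + 1 , there (there (there (here refl))) , pos-by 0 (solve [k]))
        (k + 8 * n , there (there (here refl))         , neg-by 1 (solve [k]))
    }

  S-orbit : IsOrbitOf S (3 * n + 1)
  S-orbit = record
    { sound    = inj₁ refl ∷ inj₂ (pos ≡mod-refl)
                 ∷ inj₂ (neg-by 1 (solve [k])) ∷ inj₂ (pos-by 1 (solve [k])) ∷ []
    ; complete = complete-by-three S-jumps (≤-by (6 * k + 4) (solve [k]))
        (3 * n + 1  , there (here refl)                 , pos ≡mod-refl)
        (12 * n + 1 , there (there (there (here refl))) , pos-by 0 (solve [k]))
        (k + 5 * n  , there (there (here refl))         , neg-by 1 (solve [k]))
    }

  T-orbit : IsOrbitOf T (6 * n + 1)
  T-orbit = record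
    { sound    = inj₁ refl ∷ inj₂ (neg-by 1 (solve [k]))
                 ∷ inj₂ (pos ≡mod-refl) ∷ inj₂ (neg-by 2 (solve [k])) ∷ []
    ; complete = complete-by-three T-jumps (≤-by (3 * k + 1) (solve [k]))
        (6 * n + 1  , there (there (here refl))         , pos ≡mod-refl)
        (k + 11 * n , there (there (there (here refl))) , neg-by 1 (solve [k]))
        (k + 2 * n  , there (here refl)                 , neg-by 1 (solve [k]))
    }

  jumps : ℕ → List ℕ
  jumps 0                   = R
  jumps 1                   = S
  jumps 2                   = T
  jumps (suc (suc (suc i))) = jumps i

  orbit : ℕ → ℕ
  orbit i = 1 + i * (3 * n)
  {-# INLINE orbit #-}

  jumps-JumpSet : ∀ i → JumpSet N (jumps i)
  jumps-JumpSet 0                   = R-jumps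
  jumps-JumpSet 1                   = S-jumps
  jumps-JumpSet 2                   = T-jumps
  jumps-JumpSet (suc (suc (suc i))) = jumps-JumpSet i

  jumps-Unique : ∀ i → Unique (jumps i)
  jumps-Unique 0                   = R-unique
  jumps-Unique 1                   = S-unique
  jumps-Unique 2                   = T-unique
  jumps-Unique (suc (suc (suc i))) = jumps-Unique i

  length-jumps : ∀ i → length (jumps i) ≡ 4
  length-jumps 0                   = refl
  length-jumps 1                   = refl
  length-jumps 2                   = refl
  length-jumps (suc (suc (suc i))) = length-jumps i

  3∈jumps : ∀ i → 3 ∈ jumps i
  3∈jumps 0                   = there (here refl)
  3∈jumps 1                   = here refl
  3∈jumps 2                   = here refl
  3∈jumps (suc (suc (suc i))) = 3∈jumps i

  jumps-orbit : ∀ i → IsOrbitOf (jumps i) (orbit i)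
  jumps-orbit 0                   = R-orbit
  jumps-orbit 1                   = IsOrbitOf-cong S-orbit (≡⇒≡mod (solve [k]))
  jumps-orbit 2                   = IsOrbitOf-cong T-orbit (≡⇒≡mod (solve [k]))
  jumps-orbit (suc (suc (suc i))) = IsOrbitOf-cong (jumps-orbit i) (≡mod-sym (begin
    orbit (3 + i)           ≡⟨ shift k i ⟩
    orbit i + 1 * M         ≈⟨ +-multiple-≡mod (orbit i) 1 ⟩
    orbit i                 ∎))
    where
    open ≡mod-Reasoning M
    shift : ∀ k i → 1 + (3 + i) * (3 * suc k) ≡ 1 + i * (3 * suc k) + 1 * (9 * suc k)
    shift = solve-∀

  ¬3∣orbit : ∀ i → ¬ 3 ∣ orbit i
  ¬3∣orbit i 3∣oi with %≡% (begin
    1                   ≈⟨ +-multiple-≡mod 1 (i * n) ⟨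
    1 + i * n * 3       ≡⟨ regroup k i ⟩
    orbit i             ≈⟨ ∣⇒≡mod-0 3∣oi ⟩
    0                   ∎)
    where
    open ≡mod-Reasoning 3
    regroup : ∀ k i → 1 + i * suc k * 3 ≡ 1 + i * (3 * suc k)
    regroup = solve-∀
  ... | ()

  orbit-step : ∀ i → orbit (suc i) ≡[ M ] (1 + 3 * n) * orbit i
  orbit-step i = ≡mod-sym (begin
    (1 + 3 * n) * orbit i           ≡⟨ expand k i ⟩
    orbit (suc i) + i * n * M       ≈⟨ +-multiple-≡mod (orbit (suc i)) (i * n) ⟩
    orbit (suc i)                   ∎)
    where
    open ≡mod-Reasoning M
    expand : ∀ k i → (1 + 3 * suc k) * (1 + i * (3 * suc k)) ≡ 1 + suc i * (3 * suc k) + i * suc k * (9 * suc k)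
    expand = solve-∀

  orbit-≡±⇒≡₃ : ∀ {i j} → orbit i ≡±[ M ] orbit j → i ≡[ 3 ] j
  orbit-≡±⇒≡₃ {i} {j} (pos oi≡oj) = ≡mod-*-cancelʳ (3 * n) (≡mod-modulus M≡3*3n i3n≡j3n)
    where
    M≡3*3n : M ≡ 3 * (3 * n)
    M≡3*3n = solve [k]
    i3n≡j3n : i * (3 * n) ≡[ M ] j * (3 * n)
    i3n≡j3n = ≡mod-cancelʳ-+ 1 (≡mod-trans (≡⇒≡mod (+-comm (i * (3 * n)) 1))
                                 (≡mod-trans oi≡oj (≡⇒≡mod (+-comm 1 (j * (3 * n))))))
  orbit-≡±⇒≡₃ {i} {j} (neg oi+oj≡0) with %≡% (begin
    2                                   ≈⟨ +-multiple-≡mod 2 ((i + j) * n) ⟨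
    2 + (i + j) * n * 3                 ≡⟨ regroup k i j ⟩
    orbit i + orbit j                   ≈⟨ ≡mod-∣ 3∣M oi+oj≡0 ⟩
    0                                   ∎)
    where
    open ≡mod-Reasoning 3
    regroup : ∀ k i j → 2 + (i + j) * suc k * 3 ≡ 1 + i * (3 * suc k) + (1 + j * (3 * suc k))
    regroup = solve-∀
  ... | ()

  maps-step : ∀ i → Maps n (jumps i) (jumps (suc i))
  maps-step i = orbit-maps (jumps-orbit i) (jumps-orbit (suc i)) (3∈jumps (suc i)) ∣-refl (orbit-step i)

  maps-iter : ∀ b i → Maps (b * n) (jumps i) (jumps (b + i))
  maps-iter zero    i = maps-id
  maps-iter (suc b) i = subst (λ t → Maps t (jumps i) (jumps (suc b + i))) (+-comm (b * n) n)
                              (maps-∘ (maps-iter b i) (maps-step (b + i)))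

  jumps-%3 : ∀ i → jumps (i % 3) ≡ jumps i
  jumps-%3 0                   = refl
  jumps-%3 1                   = refl
  jumps-%3 2                   = refl
  jumps-%3 (suc (suc (suc i))) =
    trans (cong jumps (trans (cong (_% 3) (+-comm 3 i)) ([m+n]%n≡m%n i 3))) (jumps-%3 i)

  jumps-cong₃ : ∀ {i j} → i ≡[ 3 ] j → jumps i ≡ jumps j
  jumps-cong₃ {i} {j} (mk≡mod i≡j) = trans (sym (jumps-%3 i)) (trans (cong jumps i≡j) (jumps-%3 j))

  image-iter : ∀ b i → SameGraph N (Image N 3 (b * n) (jumps i)) (C N (jumps (b + i)))
  image-iter b i = image-≈ b (maps-iter b i) back (8bn+bn≡bM k b)
    where
    8bn+bn≡bM : ∀ k b → 8 * b * suc k + b * suc k ≡ b * (9 * suc k)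
    8bn+bn≡bM = solve-∀
    back : Maps (8 * b * n) (jumps (b + i)) (jumps i)
    back = subst (λ A → Maps (8 * b * n) (jumps (b + i)) A) (jumps-cong₃ 9b+i≡i) (maps-iter (8 * b) (b + i))
      where
      9b+i≡i : 8 * b + (b + i) ≡[ 3 ] i
      9b+i≡i = ≡mod-trans (≡⇒≡mod (regroup b i)) (+-multiple-≡mod i (3 * b))
        where
        regroup : ∀ b i → 8 * b + (b + i) ≡ i + 3 * b * 3
        regroup = solve-∀

  circulant-image⇒n∣t : ∀ i {t X} → SameGraph N (Image N 3 t (jumps i)) (C N X) → n ∣ t
  circulant-image⇒n∣t i J≈X = *-cancelˡ-∣ 9 (circulant-image⇒M∣9t (jumps-orbit i) (¬3∣orbit i) J≈X)

  SameGraph-jumps⇒SetEq : ∀ {X} j → SameGraph N (C N X) (C N (jumps j)) → SetEq (redSet N X) (jumps j)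
  SameGraph-jumps⇒SetEq j X≈J =
    SetEq-trans (SameGraph⇒SetEq X≈J) (≡⇒SetEq (redSet-JumpSet (jumps-JumpSet j)))

  jumps-injective : ∀ i j → SameGraph N (C N (jumps i)) (C N (jumps j)) → i ≡[ 3 ] j
  jumps-injective i j Ji≈Jj = orbit-≡±⇒≡₃ (SetEq⇒orbits-≡± (jumps-orbit i) (jumps-orbit j) (¬3∣orbit i)
    (SetEq-trans (≡⇒SetEq (sym (redSet-JumpSet (jumps-JumpSet i)))) (SameGraph-jumps⇒SetEq j Ji≈Jj)))

  card≡4 : ∀ {X} j → SameGraph N (C N X) (C N (jumps j)) → card N X ≡ 4
  card≡4 j X≈J = trans (card≡length {N} (jumps-Unique j) (SameGraph-jumps⇒SetEq j X≈J)) (length-jumps j)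

  N/3≡M : N div 3 ≡ M
  N/3≡M = trans (cong (_/ 3) (sym M*3≡N)) (m*n/n≡m M 3)

  offsets-distinct : ∀ {i p} → 1 ≤ p → p ≤ 2 → ¬ orbit i ≡±[ M ] orbit (p + i)
  offsets-distinct {i} {p} 1≤p p≤2 oi≡±op+i with subst (1 ≤_) p≡0 1≤p
    where
    p≡0 : p ≡ 0
    p≡0 = ≡mod⇒≡ (s≤s p≤2) (s≤s z≤n) (≡mod-cancelʳ-+ i (≡mod-sym (orbit-≡±⇒≡₃ oi≡±op+i)))
  ... | ()

  type2 : ∀ i p {X} → 1 ≤ p → p ≤ 2 → SameGraph N (C N X) (C N (jumps (p + i))) →
          Type2Iso N 3 (jumps i) X
  type2 i p {X} 1≤p p≤2 X≈J =
    trans (card≡4 i SameGraph-refl) (sym (card≡4 (p + i) X≈J)) ,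
    subst (3 ≤_) (sym (card≡4 i SameGraph-refl)) (s≤s (s≤s (s≤s z≤n))) ,
    (λ Ji≈X → distinct (SetEq⇒orbits-≡± (jumps-orbit i) (jumps-orbit (p + i)) (¬3∣orbit i)
      (SetEq-trans (≡⇒SetEq (sym (redSet-JumpSet (jumps-JumpSet i))))
                   (SetEq-trans Ji≈X (SameGraph-jumps⇒SetEq (p + i) X≈J))))) ,
    (3 , 3∈jumps i , s≤s (s≤s z≤n) , gcd-greatest 3∣N ∣-refl) ,
    divides n (*-comm 27 n) ,
    (p * n , ≤-trans 1≤p (m≤m*n p n) , pn≤N/3∸1 , SameGraph-trans (image-iter p i) (SameGraph-sym X≈J)) ,
    (λ x x⊥N X≈xJ → ¬SetEq-scale (jumps-orbit i) (jumps-orbit (p + i)) (¬3∣orbit i) (3∈jumps (p + i))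
       distinct x⊥N (SetEq-trans (SetEq-sym (SameGraph-jumps⇒SetEq (p + i) X≈J)) X≈xJ))
    where
    distinct = offsets-distinct {i} 1≤p p≤2
    2n≤9n∸1 : 2 * n ≤ k + 8 * n
    2n≤9n∸1 = ≤-by (7 * k + 6) (solve [k])
    pn≤N/3∸1 : p * n ≤ N div 3 ∸ 1
    pn≤N/3∸1 = subst (λ D → p * n ≤ D ∸ 1) (sym N/3≡M) (≤-trans (*-monoˡ-≤ n p≤2) 2n≤9n∸1)

  type2-next : ∀ i → Type2Iso N 3 (jumps i) (jumps (1 + i))
  type2-next i = type2 i 1 ≤-refl (s≤s z≤n) SameGraph-refl

  type2-next² : ∀ i → Type2Iso N 3 (jumps i) (jumps (2 + i))
  type2-next² i = type2 i 2 (s≤s z≤n) ≤-refl SameGraph-refl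

  InT2⇒offset : ∀ i {X} → InT2 N 3 (jumps i) X → ∃[ p ] SameGraph N (C N X) (C N (jumps (p + i)))
  InT2⇒offset i     (inj₁ X≈J)   = 0 , X≈J
  InT2⇒offset i {X} (inj₂ (_ , _ , _ , _ , _ , (t , _ , _ , J≈X) , _)) =
    quotient n∣t , SameGraph-trans (SameGraph-sym J≈X′) (image-iter (quotient n∣t) i)
    where
    n∣t : n ∣ t
    n∣t = circulant-image⇒n∣t i J≈X
    J≈X′ : SameGraph N (Image N 3 (quotient n∣t * n) (jumps i)) (C N X)
    J≈X′ = subst (λ t → SameGraph N (Image N 3 t (jumps i)) (C N X)) (_∣_.equality n∣t) J≈X

  offset⇒InT2 : ∀ i q {X} → SameGraph N (C N X) (C N (jumps q)) → InT2 N 3 (jumps i) X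
  offset⇒InT2 i q {X} X≈J = by-offset (p % 3) (m%n<n p 3) (SameGraph-trans X≈J (≡⇒SameGraph (sym p%3+i≈q)))
    where
    p = q + 2 * i
    p%3+i≈q : jumps (p % 3 + i) ≡ jumps q
    p%3+i≈q = jumps-cong₃ (begin
      p % 3 + i      ≈⟨ ≡mod-+ (%-≡mod p) ≡mod-refl ⟩
      q + 2 * i + i  ≡⟨ regroup q i ⟩
      q + i * 3      ≈⟨ +-multiple-≡mod q i ⟩
      q              ∎)
      where
      open ≡mod-Reasoning 3
      regroup : ∀ q i → q + 2 * i + i ≡ q + i * 3
      regroup = solve-∀
    by-offset : ∀ r → r < 3 → SameGraph N (C N X) (C N (jumps (r + i))) → InT2 N 3 (jumps i) X
    by-offset 0                   _ X≈J = inj₁ X≈J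
    by-offset 1                   _ X≈J = inj₂ (type2 i 1 ≤-refl (s≤s z≤n) X≈J)
    by-offset 2                   _ X≈J = inj₂ (type2 i 2 (s≤s z≤n) ≤-refl X≈J)
    by-offset (suc (suc (suc _))) (s≤s (s≤s (s≤s ())))

  OneOf : List ℕ → Set
  OneOf X = SameGraph N (C N X) (C N R) ⊎ SameGraph N (C N X) (C N S) ⊎ SameGraph N (C N X) (C N T)

  OneOf⇔jumps : ∀ {X} → OneOf X ⇔ (∃[ q ] SameGraph N (C N X) (C N (jumps q)))
  OneOf⇔jumps {X} = to , from
    where
    to : OneOf X → ∃[ q ] SameGraph N (C N X) (C N (jumps q))
    to (inj₁ X≈R)        = 0 , X≈R
    to (inj₂ (inj₁ X≈S)) = 1 , X≈S
    to (inj₂ (inj₂ X≈T)) = 2 , X≈T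
    pick : ∀ r → r < 3 → SameGraph N (C N X) (C N (jumps r)) → OneOf X
    pick 0                   _ X≈R = inj₁ X≈R
    pick 1                   _ X≈S = inj₂ (inj₁ X≈S)
    pick 2                   _ X≈T = inj₂ (inj₂ X≈T)
    pick (suc (suc (suc _))) (s≤s (s≤s (s≤s ())))
    from : ∃[ q ] SameGraph N (C N X) (C N (jumps q)) → OneOf X
    from (q , X≈J) = pick (q % 3) (m%n<n q 3) (SameGraph-trans X≈J (≡⇒SameGraph (sym (jumps-%3 q))))

  InT2⇔OneOf : ∀ i X → InT2 N 3 (jumps i) X ⇔ OneOf X
  InT2⇔OneOf i X = to , from
    where
    to : InT2 N 3 (jumps i) X → OneOf X
    to X∈ with InT2⇒offset i X∈
    ... | p , X≈J = proj₂ OneOf⇔jumps (p + i , X≈J)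
    from : OneOf X → InT2 N 3 (jumps i) X
    from X∈ with proj₁ OneOf⇔jumps X∈
    ... | q , X≈J = offset⇒InT2 i q X≈J

  module Type2Group (i : ℕ) where

    Element : Set
    Element = T2Carrier N 3 (jumps i)

    offset : Element → ℕ
    offset (_ , _ , X∈) = proj₁ (InT2⇒offset i X∈)

    offset-spec : ∀ a → SameGraph N (C N (proj₁ a)) (C N (jumps (offset a + i)))
    offset-spec (_ , _ , X∈) = proj₂ (InT2⇒offset i X∈)

    offset-unique : ∀ a p → SameGraph N (C N (proj₁ a)) (C N (jumps (p + i))) → offset a ≡[ 3 ] p
    offset-unique a p a≈J = ≡mod-cancelʳ-+ i
      (jumps-injective (offset a + i) (p + i) (SameGraph-trans (SameGraph-sym (offset-spec a)) a≈J))

    element : ℕ → Element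
    element p = jumps (p + i) , jumps-JumpSet (p + i) , offset⇒InT2 i (p + i) SameGraph-refl

    offset-element : ∀ p → offset (element p) ≡[ 3 ] p
    offset-element p = offset-unique (element p) p SameGraph-refl

    _·_ : Element → Element → Element
    a · b = element (offset a + offset b)

    ε : Element
    ε = element 0

    _⁻¹ : Element → Element
    a ⁻¹ = element (2 * offset a)

    offset-isGroupMonomorphism : IsGroupMonomorphism
      (record { Carrier = Element ; _≈_ = _≈T2_ {N} {3} {jumps i} ; _∙_ = _·_ ; ε = ε ; _⁻¹ = _⁻¹ })
      (record { Carrier = ℕ ; _≈_ = _≡[ 3 ]_ ; _∙_ = _+_ ; ε = 0 ; _⁻¹ = 2 *_ })
      offset
    offset-isGroupMonomorphism = record
      { isGroupHomomorphism = record
        { isMonoidHomomorphism = record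
          { isMagmaHomomorphism = record
            { isRelHomomorphism = record
              { cong = λ {a} {b} a≈b → offset-unique a (offset b) (SameGraph-trans a≈b (offset-spec b)) }
            ; homo = λ a b → offset-element (offset a + offset b)
            }
          ; ε-homo = offset-element 0
          }
        ; ⁻¹-homo = λ a → offset-element (2 * offset a)
        }
      ; injective = λ {a} {b} oa≡ob → SameGraph-trans (offset-spec a)
          (SameGraph-trans (≡⇒SameGraph (jumps-cong₃ (≡mod-+ oa≡ob ≡mod-refl))) (SameGraph-sym (offset-spec b)))
      }

    isGroup : IsGroup (_≈T2_ {N} {3} {jumps i}) _·_ ε _⁻¹
    isGroup = GroupMonomorphism.isGroup offset-isGroupMonomorphism (≡mod-isGroup 3)

    offset-Rep : ∀ a → Rep N 3 (jumps i) a (offset a % 3 * n)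
    offset-Rep a = SameGraph-trans (image-iter (offset a % 3) i)
      (SameGraph-trans (≡⇒SameGraph (jumps-cong₃ (≡mod-+ (%-≡mod (offset a)) ≡mod-refl)))
                       (SameGraph-sym (offset-spec a)))

    Rep-offset : ∀ a t → Rep N 3 (jumps i) a t → ∃[ p ] (t ≡ p * n × offset a ≡[ 3 ] p)
    Rep-offset a t J≈a = quotient n∣t , _∣_.equality n∣t ,
      offset-unique a (quotient n∣t) (SameGraph-trans (SameGraph-sym J≈a′) (image-iter (quotient n∣t) i))
      where
      n∣t = circulant-image⇒n∣t i J≈a
      J≈a′ : Rep N 3 (jumps i) a (quotient n∣t * n)
      J≈a′ = subst (Rep N 3 (jumps i) a) (_∣_.equality n∣t) J≈a

    Rep-·-offsets : ∀ a b {p p′} → offset a ≡[ 3 ] p → offset b ≡[ 3 ] p′ →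
                    Rep N 3 (jumps i) (a · b) ((p * n + p′ * n) mod (N div 3))
    Rep-·-offsets a b {p} {p′} oa≡p ob≡p′ =
      subst (λ D → Rep N 3 (jumps i) (a · b) ((p * n + p′ * n) mod D)) (sym N/3≡M)
        (SameGraph-trans image-mod
          (subst (Rep N 3 (jumps i) (a · b)) (*-distribʳ-+ n p p′)
            (SameGraph-trans (image-iter (p + p′) i)
              (≡⇒SameGraph (jumps-cong₃ (≡mod-+ (≡mod-sym (≡mod-+ oa≡p ob≡p′)) ≡mod-refl))))))

    Rep-· : ∀ a b t t′ → Rep N 3 (jumps i) a t → Rep N 3 (jumps i) b t′ →
            Rep N 3 (jumps i) (a · b) ((t + t′) mod (N div 3))
    Rep-· a b t t′ J≈a J≈b = combine (Rep-offset a t J≈a) (Rep-offset b t′ J≈b)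
      where
      combine : ∃[ p ] (t ≡ p * n × offset a ≡[ 3 ] p) → ∃[ p′ ] (t′ ≡ p′ * n × offset b ≡[ 3 ] p′) →
                Rep N 3 (jumps i) (a · b) ((t + t′) mod (N div 3))
      combine (p , t≡pn , oa≡p) (p′ , t′≡p′n , ob≡p′) =
        subst₂ (λ u u′ → Rep N 3 (jumps i) (a · b) ((u + u′) mod (N div 3))) (sym t≡pn) (sym t′≡p′n)
               (Rep-·-offsets a b oa≡p ob≡p′)

    type2Group : IsType2Group N 3 (jumps i)
    type2Group =
      (λ a → offset a % 3 * n , offset-bound a , offset-Rep a) ,
      _·_ , ε , _⁻¹ , isGroup , Rep-·
      where
      offset-bound : ∀ a → offset a % 3 * n < N div 3
      offset-bound a = subst (offset a % 3 * n <_) (sym N/3≡M)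
        (<-≤-trans (*-monoˡ-< n (m%n<n (offset a) 3)) (*-monoˡ-≤ n (≤-by {3} 6 refl)))


theorem5p9 : (n : ℕ) → 1 ≤ n →
    let N = 27 * n
        R = 1 ∷ 3 ∷ 9 * n ∸ 1 ∷ 9 * n + 1 ∷ []
        S = 3 ∷ 3 * n + 1 ∷ 6 * n ∸ 1 ∷ 12 * n + 1 ∷ []
        T = 3 ∷ 3 * n ∸ 1 ∷ 6 * n + 1 ∷ 12 * n ∸ 1 ∷ []
    in (Type2Iso N 3 R S × Type2Iso N 3 S R × Type2Iso N 3 R T ×
        Type2Iso N 3 T R × Type2Iso N 3 S T × Type2Iso N 3 T S)
       × (∀ X → JumpSet N X →
            (InT2 N 3 R X ⇔ (SameGraph N (C N X) (C N R) ⊎ SameGraph N (C N X) (C N S) ⊎ SameGraph N (C N X) (C N T)))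
            × (InT2 N 3 S X ⇔ (SameGraph N (C N X) (C N R) ⊎ SameGraph N (C N X) (C N S) ⊎ SameGraph N (C N X) (C N T)))
            × (InT2 N 3 T X ⇔ (SameGraph N (C N X) (C N R) ⊎ SameGraph N (C N X) (C N S) ⊎ SameGraph N (C N X) (C N T))))
       × (IsType2Group N 3 R × IsType2Group N 3 S × IsType2Group N 3 T)
theorem5p9 zero    ()
theorem5p9 (suc k) _ =
  (type2-next 0 , type2-next² 1 , type2-next² 0 , type2-next 2 , type2-next 1 , type2-next² 2) ,
  (λ X _ → InT2⇔OneOf 0 X , InT2⇔OneOf 1 X , InT2⇔OneOf 2 X) ,
  (Type2Group.type2Group 0 , Type2Group.type2Group 1 , Type2Group.type2Group 2)
  where open Jumps27n k
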